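{- Let $\Gamma$ be a cubic vertex-transitive graph other than $K_{3,3}$. Let $G \leq \mathrm{Aut}(\Gamma)$ be cyclic, and let $u$ and $v$ be two adjacent vertices belonging to distinct $G$-orbits. If $|u^G| \geq |v^G|$, then $|u^G| = i|v^G|$ for some $i \in \{1,2,3\}$. Moreover, if $i \neq 1$, then every vertex in $u^G$ has exactly one neighbour in $v^G$, while every vertex in $v^G$ has exactly $i$ neighbours in $u^G$.
   Context: A cubic graph is a finite connected graph in which every vertex has valence $3$. $u^G$ denotes the orbit of $u$ under $G$. -}

module Defs where

open import Data.Nat using (ℕ; zero; suc; _<ᵇ_)
open import Data.Fin using (Fin; toℕ)
open import Data.Fin.Permutation using (Permutation; Permutation′; _⟨$⟩ʳ_)
open import Data.Bool using (Bool; true; false; _xor_)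
open import Data.List using (List; length)
open import Data.List.Membership.Propositional using (_∈_)
open import Data.List.Relation.Unary.Unique.Propositional using (Unique)
open import Data.Product using (Σ; _×_; ∃; ∃-syntax)
open import Function using (_⇔_)
open import Relation.Binary.PropositionalEquality using (_≡_; _≢_)

record Graph : Set where
  field
    n     : ℕ
    adj   : Fin n → Fin n → Bool
    sym   : ∀ x y → adj x y ≡ adj y x
    irrefl : ∀ x → adj x x ≡ false

module _ (Γ : Graph) where
  open Graph Γ

  Adj : Fin n → Fin n → Set
  Adj x y = adj x y ≡ true

  HasSize : (Fin n → Set) → ℕ → Set
  HasSize P m = Σ (List (Fin n)) λ L → Unique L × (∀ w → (w ∈ L) ⇔ P w) × (length L ≡ m)

  data Walk : Fin n → Fin n → Set where
    here : ∀ {x} → Walk x x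
    step : ∀ {x y z} → Adj x y → Walk y z → Walk x z

  Connected : Set
  Connected = ∀ x y → Walk x y

  Cubic : Set
  Cubic = Connected × (∀ x → HasSize (Adj x) 3)

  IsAut : Permutation′ n → Set
  IsAut σ = ∀ x y → adj (σ ⟨$⟩ʳ x) (σ ⟨$⟩ʳ y) ≡ adj x y

  Aut : Set
  Aut = Σ (Permutation′ n) IsAut

  VertexTransitive : Set
  VertexTransitive = ∀ x y → ∃[ σ ] (IsAut σ × (σ ⟨$⟩ʳ x ≡ y))

  pow : Permutation′ n → ℕ → Fin n → Fin n
  pow σ zero x = x
  pow σ (suc k) x = σ ⟨$⟩ʳ pow σ k x

  -- Orbit of u under the cyclic group ⟨g⟩ (finite, so its elements are the g^k, k ≥ 0).
  InOrbit : Permutation′ n → Fin n → Fin n → Set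
  InOrbit g u w = ∃[ k ] (pow g k u ≡ w)

  NbrsIn : Fin n → (Fin n → Set) → ℕ → Set
  NbrsIn x P m = HasSize (λ y → Adj x y × P y) m

Isomorphic : Graph → Graph → Set
Isomorphic Γ Δ = Σ (Permutation (Graph.n Γ) (Graph.n Δ)) λ σ →
  ∀ x y → Graph.adj Δ (σ ⟨$⟩ʳ x) (σ ⟨$⟩ʳ y) ≡ Graph.adj Γ x y

K33 : Graph
K33 = record
  { n = 6
  ; adj = λ x y → (toℕ x <ᵇ 3) xor (toℕ y <ᵇ 3)
  ; sym = λ x y → xor-comm (toℕ x <ᵇ 3) (toℕ y <ᵇ 3)
  ; irrefl = λ x → xor-self (toℕ x <ᵇ 3)
  }
  where
  xor-comm : ∀ a b → (a xor b) ≡ (b xor a)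
  xor-comm false false = _≡_.refl
  xor-comm false true = _≡_.refl
  xor-comm true false = _≡_.refl
  xor-comm true true = _≡_.refl
  xor-self : ∀ a → (a xor a) ≡ false
  xor-self false = _≡_.refl
  xor-self true = _≡_.refl

-- Let σ generate G, a = |u^G| and b = |v^G|. The stabiliser of v is generated by σ^b; it permutes
-- the three neighbours of v, so σ^(rb) fixes u for some r ≤ 3, i.e. a ∣ rb. Together with b ≤ a this
-- leaves a ∈ {b, 2b, 3b} or 2a = 3b. When a = ib with i ∈ {2, 3}, the neighbours of v in u^G are
-- exactly the i points σ^(jb) u, and since the stabiliser of v is transitive on them, v is the only
-- neighbour of u in v^G. When 2a = 3b, σ^a fixes u^G ⊇ N(v) pointwise but moves v, so v and σ^a v
-- are distinct vertices with the same neighbourhood; in a cubic vertex-transitive graph that forces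
-- K_{3,3}.
module Submission where

open import Defs
open import Data.Bool using (true; false; _xor_)
open import Data.Bool.Properties using (¬-not; ⇔→≡)
open import Data.Empty using (⊥; ⊥-elim)
open import Data.Fin using (Fin; toℕ; zero; suc)
open import Data.Fin.Patterns using (0F; 1F; 2F; 3F; 4F; 5F)
open import Data.Fin.Properties using (_≟_)
open import Data.Fin.Permutation using (Permutation′; permutation; _⟨$⟩ʳ_; _⟨$⟩ˡ_; inverseʳ)
open import Data.List using (List; []; _∷_; _++_; length; lookup; applyUpTo)
open import Data.List.Properties using (length-applyUpTo; length-removeAt′)
open import Data.List.Membership.Propositional using (_∈_)
open import Data.List.Membership.Propositional.Properties
  using (∈-lookup; ∈-applyUpTo⁺; ∈-applyUpTo⁻; ∈-++⁺ˡ; ∈-++⁺ʳ)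
import Data.List.Relation.Unary.All as All
open import Data.List.Relation.Unary.All.Properties using (¬Any⇒All¬)
open import Data.List.Relation.Unary.Any using (here; there; index; _─_)
open import Data.List.Relation.Unary.Any.Properties using (lookup-index)
open import Data.List.Relation.Unary.Unique.Propositional using (Unique; []; _∷_)
open import Data.List.Relation.Unary.Unique.Propositional.Properties using (applyUpTo⁺₁; ++⁺)
open import Data.List.Relation.Binary.Disjoint.Propositional using (Disjoint)
open import Data.Nat
  using (ℕ; zero; suc; _+_; _*_; _∸_; _%_; _/_; _≤_; _<_; _<ᵇ_; z≤n; s≤s; s≤s⁻¹; z<s; NonZero; >-nonZero)
open import Data.Nat.Divisibility using (_∣_; _∤_; divides; >⇒∤; ∣m+n∣m⇒∣n; ∣-refl; m%n≡0⇒n∣m; m∣m*n)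
open import Data.Nat.DivMod using (m≡m%n+[m/n]*n; m%n<n)
open import Data.Nat.Properties
  using (module ≤-Reasoning; 1+n≰n; +-comm; m+[n∸m]≡n; m<n⇒0<n∸m; ≤-<-trans; m∸n≤m; <⇒≤; <⇒≱;
         m≤n⇒m<n∨m≡n; m+n∸n≡m; *-distribˡ-∸; m∸n+n≡m; n≢0⇒n>0; <⇒≢; m<m+n; <-≤-trans; m≤m+n;
         <-trans; *-cancelʳ-≤; *-monoʳ-≤; m+n≡0⇒m≡0; *-identityˡ; *-cancelˡ-≡; +-identityʳ;
         *-distribʳ-∸; *-monoˡ-≤; *-monoˡ-<)
open import Data.Nat.Tactic.RingSolver using (solve-∀)
open import Data.Product using (_×_; _,_; proj₁; proj₂; map₂; uncurry; ∃-syntax)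
open import Data.Sum using (_⊎_; inj₁; inj₂; [_,_]′)
open import Function using (_∘_; _⇔_; Equivalence; mk⇔)
open import Function.Bundles using (Injection)
open import Function.Definitions using (Injective; StrictlySurjective)
open import Function.Properties.Inverse using (↔⇒↣)
open import Relation.Binary using (Rel; IsEquivalence)
open import Relation.Binary.PropositionalEquality
open import Relation.Nullary using (¬_; yes; no)

open Equivalence using (to; from)

module _ {ℓ} {A : Set ℓ} where

  ∈-─⁺ : ∀ {x y : A} {M} (x∈M : x ∈ M) → y ∈ M → y ≢ x → y ∈ (M ─ x∈M)
  ∈-─⁺ (here refl) (here refl) y≢x = ⊥-elim (y≢x refl)
  ∈-─⁺ (here _)    (there y∈M) _   = y∈M
  ∈-─⁺ (there _)   (here y≡z)  _   = here y≡z
  ∈-─⁺ (there x∈M) (there y∈M) y≢x = there (∈-─⁺ x∈M y∈M y≢x)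

  Unique-⊆⇒length-≤ : ∀ {L M : List A} → Unique L → (∀ {w} → w ∈ L → w ∈ M) → length L ≤ length M
  Unique-⊆⇒length-≤ {[]}    _            _   = z≤n
  Unique-⊆⇒length-≤ {x ∷ L} {M} (x∉L ∷ uL) L⊆M = begin
    suc (length L)         ≤⟨ s≤s (Unique-⊆⇒length-≤ uL L⊆M─x) ⟩
    suc (length (M ─ x∈M)) ≡⟨ length-removeAt′ M (index x∈M) ⟨
    length M               ∎
    where
    open ≤-Reasoning
    x∈M : x ∈ M
    x∈M = L⊆M (here refl)
    L⊆M─x : ∀ {w} → w ∈ L → w ∈ (M ─ x∈M)
    L⊆M─x w∈L = ∈-─⁺ x∈M (L⊆M (there w∈L)) (≢-sym (All.lookup x∉L w∈L))

  Unique⇒lookup-injective : ∀ {L : List A} → Unique L → Injective _≡_ _≡_ (lookup L)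
  Unique⇒lookup-injective {_ ∷ _} _         {zero}  {zero}  _  = refl
  Unique⇒lookup-injective (x∉L ∷ _) {zero}  {suc j} eq = ⊥-elim (All.lookup x∉L (∈-lookup j) eq)
  Unique⇒lookup-injective (x∉L ∷ _) {suc i} {zero}  eq = ⊥-elim (All.lookup x∉L (∈-lookup i) (sym eq))
  Unique⇒lookup-injective (_ ∷ uL)  {suc i} {suc j} eq = cong suc (Unique⇒lookup-injective uL eq)

module _ {ℓ r} {A : Set ℓ} {R : Rel A r} (isEquivalence : IsEquivalence R) where
  open IsEquivalence isEquivalence renaming (refl to R-refl; sym to R-sym; trans to R-trans)

  partnered-triple : ∀ {p q s} → let T = p ∷ q ∷ s ∷ [] in
    (∀ {z} → z ∈ T → ∃[ z′ ] (z′ ∈ T × z′ ≢ z × R z z′)) → ∀ {z} → z ∈ T → R p z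
  partnered-triple partner with partner (here refl)
  ... | _ , here z′≡p , z′≢p , _ = ⊥-elim (z′≢p z′≡p)
  ... | _ , there (here refl) , _ , Rpq with partner (there (there (here refl)))
  ...   | _ , here refl , _ , Rsp = λ { (here refl)                 → R-refl
                                    ; (there (here refl))         → Rpq
                                    ; (there (there (here refl))) → R-sym Rsp }
  ...   | _ , there (here refl) , _ , Rsq = λ { (here refl)                 → R-refl
                                            ; (there (here refl))         → Rpq
                                            ; (there (there (here refl))) → R-trans Rpq (R-sym Rsq) }
  ...   | _ , there (there (here z′≡s)) , z′≢s , _ = ⊥-elim (z′≢s z′≡s)
  partnered-triple partner | _ , there (there (here refl)) , _ , Rps with partner (there (here refl))
  ...   | _ , here refl , _ , Rqp = λ { (here refl)                 → R-refl
                                    ; (there (here refl))         → R-sym Rqp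
                                    ; (there (there (here refl))) → Rps }
  ...   | _ , there (here z′≡q) , z′≢q , _ = ⊥-elim (z′≢q z′≡q)
  ...   | _ , there (there (here refl)) , _ , Rqs = λ { (here refl)                 → R-refl
                                                    ; (there (here refl))         → R-trans Rps (R-sym Rqs)
                                                    ; (there (there (here refl))) → Rps }

bijection⇒Isomorphic : (Γ Δ : Graph) (h : Fin (Graph.n Δ) → Fin (Graph.n Γ)) →
  Injective _≡_ _≡_ h → StrictlySurjective _≡_ h →
  (∀ i j → Graph.adj Γ (h i) (h j) ≡ Graph.adj Δ i j) → Isomorphic Γ Δ
bijection⇒Isomorphic Γ Δ h h-injective h-surjective h-adj =
  permutation h⁻¹ h (λ i → h-injective (h∘h⁻¹ (h i))) h∘h⁻¹ , adj-h⁻¹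
  where
  open ≡-Reasoning
  h⁻¹ : Fin (Graph.n Γ) → Fin (Graph.n Δ)
  h⁻¹ = proj₁ ∘ h-surjective
  h∘h⁻¹ : ∀ x → h (h⁻¹ x) ≡ x
  h∘h⁻¹ = proj₂ ∘ h-surjective
  adj-h⁻¹ : ∀ x y → Graph.adj Δ (h⁻¹ x) (h⁻¹ y) ≡ Graph.adj Γ x y
  adj-h⁻¹ x y = begin
    Graph.adj Δ (h⁻¹ x) (h⁻¹ y)         ≡⟨ h-adj (h⁻¹ x) (h⁻¹ y) ⟨
    Graph.adj Γ (h (h⁻¹ x)) (h (h⁻¹ y)) ≡⟨ cong₂ (Graph.adj Γ) (h∘h⁻¹ x) (h∘h⁻¹ y) ⟩
    Graph.adj Γ x y                     ∎

module _ (Γ : Graph) where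
  open Graph Γ using (n; adj; irrefl) renaming (sym to adj-sym)
  open import Data.List.Membership.DecPropositional (_≟_ {n}) using (_∈?_)

  HasSize⇒length-≤ : ∀ {P m K} → HasSize Γ P m → Unique K → (∀ {w} → w ∈ K → P w) → length K ≤ m
  HasSize⇒length-≤ (L , _ , L≐P , refl) uK K⊆P =
    Unique-⊆⇒length-≤ uK (λ w∈K → from (L≐P _) (K⊆P w∈K))

  HasSize⇒≤-length : ∀ {P m K} → HasSize Γ P m → (∀ w → P w → w ∈ K) → m ≤ length K
  HasSize⇒≤-length (L , uL , L≐P , refl) P⊆K =
    Unique-⊆⇒length-≤ uL (λ w∈L → P⊆K _ (to (L≐P _) w∈L))

  HasSize-exhausted : ∀ {P m K} → HasSize Γ P m → Unique K → length K ≡ m →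
    (∀ {w} → w ∈ K → P w) → ∀ w → P w → w ∈ K
  HasSize-exhausted {P} {K = K} size uK refl K⊆P w Pw with w ∈? K
  ... | yes w∈K = w∈K
  ... | no  w∉K = ⊥-elim (1+n≰n (HasSize⇒length-≤ size (¬Any⇒All¬ K w∉K ∷ uK) w∷K⊆P))
    where
    w∷K⊆P : ∀ {z} → z ∈ w ∷ K → P z
    w∷K⊆P (here refl) = Pw
    w∷K⊆P (there z∈K) = K⊆P z∈K

  HasSize-⊆⇒⊇ : ∀ {P Q m} → HasSize Γ P m → HasSize Γ Q m → (∀ w → P w → Q w) → ∀ w → Q w → P w
  HasSize-⊆⇒⊇ (L , uL , L≐P , refl) Q-size P⊆Q w Qw =
    to (L≐P w) (HasSize-exhausted Q-size uL refl (λ z∈L → P⊆Q _ (to (L≐P _) z∈L)) w Qw)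

  HasSize-cong : ∀ {P Q m} → (∀ w → P w ⇔ Q w) → HasSize Γ P m → HasSize Γ Q m
  HasSize-cong P⇔Q (L , uL , L≐P , len) =
    L , uL , (λ w → mk⇔ (to (P⇔Q w) ∘ to (L≐P w)) (from (L≐P w) ∘ from (P⇔Q w))) , len

  NbrsIn-cong : ∀ {z P Q m} → (∀ w → P w ⇔ Q w) → NbrsIn Γ z P m → NbrsIn Γ z Q m
  NbrsIn-cong P⇔Q = HasSize-cong λ w → mk⇔ (map₂ (to (P⇔Q w))) (map₂ (from (P⇔Q w)))

  NeighboursAre : Fin n → List (Fin n) → Set
  NeighboursAre z L = ∀ w → w ∈ L ⇔ Adj Γ z w

  Twins : Fin n → Fin n → Set
  Twins z z′ = ∀ w → adj z w ≡ adj z′ w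

  Twins-isEquivalence : IsEquivalence Twins
  Twins-isEquivalence = record
    { refl  = λ _ → refl
    ; sym   = λ z≈z′ w → sym (z≈z′ w)
    ; trans = λ z≈z′ z′≈z″ w → trans (z≈z′ w) (z′≈z″ w)
    }

  IsAut-preserves-Twins : ∀ {τ z z′} → IsAut Γ τ → Twins z z′ → Twins (τ ⟨$⟩ʳ z) (τ ⟨$⟩ʳ z′)
  IsAut-preserves-Twins {τ} {z} {z′} τ-aut z≈z′ w = begin
    adj (τ ⟨$⟩ʳ z) w                    ≡⟨ cong (adj (τ ⟨$⟩ʳ z)) (inverseʳ τ) ⟨
    adj (τ ⟨$⟩ʳ z) (τ ⟨$⟩ʳ (τ ⟨$⟩ˡ w))  ≡⟨ τ-aut z (τ ⟨$⟩ˡ w) ⟩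
    adj z (τ ⟨$⟩ˡ w)                    ≡⟨ z≈z′ (τ ⟨$⟩ˡ w) ⟩
    adj z′ (τ ⟨$⟩ˡ w)                   ≡⟨ τ-aut z′ (τ ⟨$⟩ˡ w) ⟨
    adj (τ ⟨$⟩ʳ z′) (τ ⟨$⟩ʳ (τ ⟨$⟩ˡ w)) ≡⟨ cong (adj (τ ⟨$⟩ʳ z′)) (inverseʳ τ) ⟩
    adj (τ ⟨$⟩ʳ z′) w                   ∎
    where open ≡-Reasoning

  twins-everywhere : VertexTransitive Γ → ∀ {v v′} → v ≢ v′ → Twins v v′ →
    ∀ z → ∃[ z′ ] (z′ ≢ z × Twins z z′)
  twins-everywhere vt {v} {v′} v≢v′ v≈v′ z with vt v z
  ... | τ , τ-aut , refl =
    τ ⟨$⟩ʳ v′ ,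
    (λ τv′≡τv → v≢v′ (sym (Injection.injective (↔⇒↣ τ) τv′≡τv))) ,
    IsAut-preserves-Twins {τ} τ-aut v≈v′

  Connected⇒closed-all : Connected Γ → ∀ {P : Fin n → Set} → (∀ {z w} → P z → Adj Γ z w → P w) →
    ∀ {x} → P x → ∀ z → P z
  Connected⇒closed-all connected {P} closed {x} Px z = along (connected x z) Px
    where
    along : ∀ {y z} → Walk Γ y z → P y → P z
    along here           Py = Py
    along (step y~w walk) Py = along walk (closed Py y~w)

  module _ (connected : Connected Γ) {x₀ x₁ x₂ y₀ y₁ y₂ : Fin n} where
    private
      X Y : List (Fin n)
      X = x₀ ∷ x₁ ∷ x₂ ∷ []
      Y = y₀ ∷ y₁ ∷ y₂ ∷ []

    complete-bipartite⇒K33 : Unique X → Unique Y →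
      (∀ {x} → x ∈ X → NeighboursAre x Y) → (∀ {y} → y ∈ Y → NeighboursAre y X) → Isomorphic Γ K33
    complete-bipartite⇒K33 uX uY N[X] N[Y] =
      bijection⇒Isomorphic Γ K33 h (Unique⇒lookup-injective (++⁺ uX uY X∩Y≡∅)) h-surjective h-adj
      where
      h : Fin 6 → Fin n
      h = lookup (X ++ Y)

      X∩Y≡∅ : Disjoint X Y
      X∩Y≡∅ (z∈X , z∈Y) with trans (sym (to (N[X] z∈X _) z∈Y)) (irrefl _)
      ... | ()

      covered : ∀ z → z ∈ X ⊎ z ∈ Y
      covered = Connected⇒closed-all connected closed (inj₁ (here refl))
        where
        closed : ∀ {z w} → z ∈ X ⊎ z ∈ Y → Adj Γ z w → w ∈ X ⊎ w ∈ Y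
        closed (inj₁ z∈X) z~w = inj₂ (from (N[X] z∈X _) z~w)
        closed (inj₂ z∈Y) z~w = inj₁ (from (N[Y] z∈Y _) z~w)

      h-surjective : StrictlySurjective _≡_ h
      h-surjective z = index z∈X++Y , sym (lookup-index z∈X++Y)
        where
        z∈X++Y : z ∈ X ++ Y
        z∈X++Y = [ ∈-++⁺ˡ , ∈-++⁺ʳ X ]′ (covered z)

      side : ∀ i → ((toℕ i <ᵇ 3) ≡ true × h i ∈ X) ⊎ ((toℕ i <ᵇ 3) ≡ false × h i ∈ Y)
      side 0F = inj₁ (refl , here refl)
      side 1F = inj₁ (refl , there (here refl))
      side 2F = inj₁ (refl , there (there (here refl)))
      side 3F = inj₂ (refl , here refl)
      side 4F = inj₂ (refl , there (here refl))
      side 5F = inj₂ (refl , there (there (here refl)))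

      h-adj : ∀ i j → adj (h i) (h j) ≡ (toℕ i <ᵇ 3) xor (toℕ j <ᵇ 3)
      h-adj i j with side i | side j
      ... | inj₁ (i<3 , hi∈X) | inj₁ (j<3 , hj∈X) rewrite i<3 | j<3 =
        ¬-not (λ hi~hj → X∩Y≡∅ (hj∈X , from (N[X] hi∈X _) hi~hj))
      ... | inj₁ (i<3 , hi∈X) | inj₂ (j≥3 , hj∈Y) rewrite i<3 | j≥3 = to (N[X] hi∈X _) hj∈Y
      ... | inj₂ (i≥3 , hi∈Y) | inj₁ (j<3 , hj∈X) rewrite i≥3 | j<3 = to (N[Y] hi∈Y _) hj∈X
      ... | inj₂ (i≥3 , hi∈Y) | inj₂ (j≥3 , hj∈Y) rewrite i≥3 | j≥3 =
        ¬-not (λ hi~hj → X∩Y≡∅ (from (N[Y] hi∈Y _) hi~hj , hj∈Y))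

  -- Vertex-transitivity spreads one pair of twins to a twin for every vertex; the twins among the
  -- neighbours of v then force all three of them to share one neighbourhood, which is K_{3,3}.
  twins⇒K33 : Cubic Γ → VertexTransitive Γ → ∀ {v v′} → v ≢ v′ → Twins v v′ → Isomorphic Γ K33
  twins⇒K33 (connected , cubic) vt {v} v≢v′ v≈v′ with cubic v
  ... | x₀ ∷ x₁ ∷ x₂ ∷ [] , uX , N[v] , refl with cubic x₀
  ... | y₀ ∷ y₁ ∷ y₂ ∷ [] , uY , N[x₀] , refl = complete-bipartite⇒K33 connected uX uY N[X] N[Y]
    where
    X : List (Fin n)
    X = x₀ ∷ x₁ ∷ x₂ ∷ []

    twin-in-X : ∀ {x} → x ∈ X → ∃[ x′ ] (x′ ∈ X × x′ ≢ x × Twins x x′)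
    twin-in-X {x} x∈X with twins-everywhere vt v≢v′ v≈v′ x
    ... | x′ , x′≢x , x≈x′ = x′ , from (N[v] x′) v~x′ , x′≢x , x≈x′
      where
      v~x′ : Adj Γ v x′
      v~x′ = trans (adj-sym v x′) (trans (sym (x≈x′ v)) (trans (adj-sym x v) (to (N[v] x) x∈X)))

    x₀≈X : ∀ {x} → x ∈ X → Twins x₀ x
    x₀≈X = partnered-triple Twins-isEquivalence twin-in-X

    N[X] : ∀ {x} → x ∈ X → NeighboursAre x (y₀ ∷ y₁ ∷ y₂ ∷ [])
    N[X] x∈X w = mk⇔ (λ w∈Y → trans (sym (x₀≈X x∈X w)) (to (N[x₀] w) w∈Y))
                     (λ x~w → from (N[x₀] w) (trans (x₀≈X x∈X w) x~w))

    N[Y] : ∀ {y} → y ∈ y₀ ∷ y₁ ∷ y₂ ∷ [] → NeighboursAre y X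
    N[Y] {y} y∈Y w = mk⇔ (λ w∈X → y~X w∈X) (HasSize-exhausted (cubic y) uX refl y~X w)
      where
      y~X : ∀ {x} → x ∈ X → Adj Γ y x
      y~X {x} x∈X = trans (adj-sym y x) (to (N[X] x∈X y) y∈Y)

module Powers (Γ : Graph) (σ : Permutation′ (Graph.n Γ)) where
  open Graph Γ using (n)

  σ^ : ℕ → Fin n → Fin n
  σ^ = pow Γ σ

  σ^-+ : ∀ m k x → σ^ (m + k) x ≡ σ^ m (σ^ k x)
  σ^-+ zero    k x = refl
  σ^-+ (suc m) k x = cong (σ ⟨$⟩ʳ_) (σ^-+ m k x)

  σ^-comm : ∀ m k x → σ^ m (σ^ k x) ≡ σ^ k (σ^ m x)
  σ^-comm m k x = begin
    σ^ m (σ^ k x) ≡⟨ σ^-+ m k x ⟨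
    σ^ (m + k) x  ≡⟨ cong (λ e → σ^ e x) (+-comm m k) ⟩
    σ^ (k + m) x  ≡⟨ σ^-+ k m x ⟩
    σ^ k (σ^ m x) ∎
    where open ≡-Reasoning

  σ^-injective : ∀ k {x y} → σ^ k x ≡ σ^ k y → x ≡ y
  σ^-injective zero    eq = eq
  σ^-injective (suc k) eq = σ^-injective k (Injection.injective (↔⇒↣ σ) eq)

  σ^-≡⇒return : ∀ {i j} x → i ≤ j → σ^ i x ≡ σ^ j x → σ^ (j ∸ i) x ≡ x
  σ^-≡⇒return {i} {j} x i≤j eq = sym (σ^-injective i (begin
    σ^ i x                ≡⟨ eq ⟩
    σ^ j x                ≡⟨ cong (λ e → σ^ e x) (m+[n∸m]≡n i≤j) ⟨
    σ^ (i + (j ∸ i)) x    ≡⟨ σ^-+ i (j ∸ i) x ⟩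
    σ^ i (σ^ (j ∸ i) x)   ∎))
    where open ≡-Reasoning

  σ^-*-fixed : ∀ q {p x} → σ^ p x ≡ x → σ^ (q * p) x ≡ x
  σ^-*-fixed zero    fx = refl
  σ^-*-fixed (suc q) {p} {x} fx =
    trans (σ^-+ p (q * p) x) (trans (cong (σ^ p) (σ^-*-fixed q fx)) fx)

  σ^-∣-fixed : ∀ {p k x} → σ^ p x ≡ x → p ∣ k → σ^ k x ≡ x
  σ^-∣-fixed fx (divides q refl) = σ^-*-fixed q fx

  σ^-fixed-on-orbit : ∀ {p x} → σ^ p x ≡ x → ∀ k → σ^ p (σ^ k x) ≡ σ^ k x
  σ^-fixed-on-orbit {p} {x} fx k = trans (σ^-comm p k x) (cong (σ^ k) fx)

  σ^-% : ∀ {p x} .{{_ : NonZero p}} → σ^ p x ≡ x → ∀ k → σ^ k x ≡ σ^ (k % p) x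
  σ^-% {p} {x} fx k = begin
    σ^ k x                          ≡⟨ cong (λ e → σ^ e x) (m≡m%n+[m/n]*n k p) ⟩
    σ^ (k % p + k / p * p) x        ≡⟨ σ^-+ (k % p) (k / p * p) x ⟩
    σ^ (k % p) (σ^ (k / p * p) x)   ≡⟨ cong (σ^ (k % p)) (σ^-*-fixed (k / p) fx) ⟩
    σ^ (k % p) x                    ∎
    where open ≡-Reasoning

  σ^-undo : ∀ {p x} → 0 < p → σ^ p x ≡ x → ∀ k → ∃[ m ] (σ^ m (σ^ k x) ≡ x)
  σ^-undo {suc p} {x} _ fx k = p * k , (begin
    σ^ (p * k) (σ^ k x) ≡⟨ σ^-+ (p * k) k x ⟨
    σ^ (p * k + k) x    ≡⟨ cong (λ e → σ^ e x) (+-comm (p * k) k) ⟩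
    σ^ (suc p * k) x    ≡⟨ σ^-∣-fixed fx (m∣m*n {suc p} k) ⟩
    x                   ∎)
    where open ≡-Reasoning

  NoReturnBefore : Fin n → ℕ → Set
  NoReturnBefore x k = ∀ j → 0 < j → j < k → σ^ j x ≢ x

  NoReturnBefore⇒distinct : ∀ {x i j k} → NoReturnBefore x k → i < j → j < k → σ^ i x ≢ σ^ j x
  NoReturnBefore⇒distinct {x} {i} {j} noReturn i<j j<k eq =
    noReturn (j ∸ i) (m<n⇒0<n∸m i<j) (≤-<-trans (m∸n≤m j i) j<k) (σ^-≡⇒return x (<⇒≤ i<j) eq)

  Period : Fin n → ℕ → Set
  Period x p = 0 < p × σ^ p x ≡ x × NoReturnBefore x p

  period-fixed⇒∣ : ∀ {x p k} → Period x p → σ^ k x ≡ x → p ∣ k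
  period-fixed⇒∣ {x} {p} {k} (0<p , fx , noReturn) fixed = m%n≡0⇒n∣m k p k%p≡0
    where
    instance _ = >-nonZero 0<p
    k%p≡0 : k % p ≡ 0
    k%p≡0 with k % p | m%n<n k p | σ^-% fx k
    ... | zero  | _   | _    = refl
    ... | suc r | r<p | k≡r = ⊥-elim (noReturn (suc r) z<s r<p (trans (sym k≡r) fixed))

  period-transfer : ∀ {x y p} → Period x p → σ^ p y ≡ y →
    ∀ c e → σ^ c x ≡ σ^ e x → σ^ c y ≡ σ^ e y
  period-transfer {x} {y} {p} per@(0<p , fx , _) fy c e σᶜx≡σᵉx = σ^-injective m (begin
    σ^ m (σ^ c y) ≡⟨ σ^-+ m c y ⟨
    σ^ (m + c) y  ≡⟨ σ^-∣-fixed fy p∣m+c ⟩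
    y             ≡⟨ σ^-∣-fixed fy p∣m+e ⟨
    σ^ (m + e) y  ≡⟨ σ^-+ m e y ⟩
    σ^ m (σ^ e y) ∎)
    where
    open ≡-Reasoning
    m : ℕ
    m = proj₁ (σ^-undo 0<p fx e)
    undo : σ^ m (σ^ e x) ≡ x
    undo = proj₂ (σ^-undo 0<p fx e)
    p∣m+e : p ∣ m + e
    p∣m+e = period-fixed⇒∣ per (trans (σ^-+ m e x) undo)
    p∣m+c : p ∣ m + c
    p∣m+c = period-fixed⇒∣ per (trans (σ^-+ m c x) (trans (cong (σ^ m) σᶜx≡σᵉx) undo))

  period-shift : ∀ {x p} → Period x p → ∀ k → Period (σ^ k x) p
  period-shift {x} {p} (0<p , fx , noReturn) k =
    0<p , σ^-fixed-on-orbit {p} fx k ,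
    λ j 0<j j<p σʲσᵏx≡σᵏx →
      noReturn j 0<j j<p (σ^-injective k (trans (σ^-comm k j x) σʲσᵏx≡σᵏx))

  orbit-shift : ∀ {x p} → Period x p → ∀ k w → InOrbit Γ σ (σ^ k x) w ⇔ InOrbit Γ σ x w
  orbit-shift {x} (0<p , fx , _) k w = mk⇔
    (λ (j , σʲσᵏx≡w) → j + k , trans (σ^-+ j k x) σʲσᵏx≡w)
    (λ (j , σʲx≡w) → j + m , trans (σ^-+ j m (σ^ k x)) (trans (cong (σ^ j) undo) σʲx≡w))
    where
    m : ℕ
    m = proj₁ (σ^-undo 0<p fx k)
    undo : σ^ m (σ^ k x) ≡ x
    undo = proj₂ (σ^-undo 0<p fx k)

  orbitList : Fin n → ℕ → List (Fin n)
  orbitList x k = applyUpTo (λ i → σ^ i x) k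

  orbit-⊆-orbitList : ∀ {x p w} .{{_ : NonZero p}} → σ^ p x ≡ x →
    InOrbit Γ σ x w → w ∈ orbitList x p
  orbit-⊆-orbitList {x} {p} fx (k , refl) =
    subst (_∈ orbitList x p) (sym (σ^-% fx k)) (∈-applyUpTo⁺ (λ i → σ^ i x) (m%n<n k p))

  orbit-size⇒period : ∀ {x a} → HasSize Γ (InOrbit Γ σ x) a → Period x a
  orbit-size⇒period {x} {a} size = 0<a , returns , noReturn
    where
    0<a : 0 < a
    0<a = HasSize⇒length-≤ Γ {K = x ∷ []} size (All.[] ∷ []) λ { (here refl) → 0 , refl }

    noReturn : NoReturnBefore x a
    noReturn j 0<j j<a fixed = <⇒≱ j<a (subst (a ≤_) (length-applyUpTo (λ i → σ^ i x) j)
      (HasSize⇒≤-length Γ size (λ _ → orbit-⊆-orbitList {{>-nonZero 0<j}} fixed)))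

    returns : σ^ a x ≡ x
    returns with σ^ a x ≟ x
    ... | yes fixed = fixed
    ... | no  moved = ⊥-elim (1+n≰n (subst (_≤ a) (length-applyUpTo (λ i → σ^ i x) (suc a))
      (HasSize⇒length-≤ Γ size (applyUpTo⁺₁ _ _ (NoReturnBefore⇒distinct noReturn′)) in-orbit)))
      where
      noReturn′ : NoReturnBefore x (suc a)
      noReturn′ j 0<j j<1+a with m≤n⇒m<n∨m≡n (s≤s⁻¹ j<1+a)
      ... | inj₁ j<a  = noReturn j 0<j j<a
      ... | inj₂ refl = moved
      in-orbit : ∀ {w} → w ∈ orbitList x (suc a) → InOrbit Γ σ x w
      in-orbit w∈ with ∈-applyUpTo⁻ (λ i → σ^ i x) w∈
      ... | i , _ , refl = i , refl

∤-below : ∀ {p k} → 0 < k → k < p → p ∤ k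
∤-below 0<k k<p = >⇒∤ {{>-nonZero 0<k}} k<p

∤-between : ∀ {p t} → 0 < t → t < p → p ∤ p + t
∤-between 0<t t<p p∣p+t = ∤-below 0<t t<p (∣m+n∣m⇒∣n p∣p+t ∣-refl)

3b≡2a⇒thirds : ∀ {a b} → 0 < b → b ≤ a → 3 * b ≡ 2 * a → ∃[ t ] (0 < t × a ≡ 3 * t × b ≡ 2 * t)
3b≡2a⇒thirds {a} {b} 0<b b≤a 3b≡2a = a ∸ b , 0<t , a≡3t , sym 2t≡b
  where
  open ≡-Reasoning
  2t≡b : 2 * (a ∸ b) ≡ b
  2t≡b = begin
    2 * (a ∸ b)     ≡⟨ *-distribˡ-∸ 2 a b ⟩
    2 * a ∸ 2 * b   ≡⟨ cong (_∸ 2 * b) 3b≡2a ⟨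
    3 * b ∸ 2 * b   ≡⟨ m+n∸n≡m b (2 * b) ⟩
    b               ∎
  a≡3t : a ≡ 3 * (a ∸ b)
  a≡3t = begin
    a               ≡⟨ m∸n+n≡m b≤a ⟨
    a ∸ b + b       ≡⟨ cong (a ∸ b +_) 2t≡b ⟨
    3 * (a ∸ b)     ∎
  0<t : 0 < a ∸ b
  0<t = n≢0⇒n>0 (λ t≡0 → <⇒≢ 0<b (trans (sym (cong (2 *_) t≡0)) 2t≡b))

ratio-3:2-nondivisibility : ∀ {t} → 0 < t → 2 * t ∤ 3 * t × 3 * t ∤ 1 * (2 * t) × 3 * t ∤ 2 * (2 * t)
ratio-3:2-nondivisibility {t} 0<t =
  subst (2 * t ∤_) (2t+t≡3t t) (∤-between 0<t t<2t) ,
  ∤-below (<-≤-trans 0<t (subst (t ≤_) (t+t≡1*2t t) (m≤m+n t t)))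
          (subst (1 * (2 * t) <_) (1*2t+t≡3t t) (m<m+n (1 * (2 * t)) 0<t)) ,
  subst (3 * t ∤_) (3t+t≡2*2t t) (∤-between 0<t (<-trans t<2t 2t<3t))
  where
  t+t≡2t : ∀ t → t + t ≡ 2 * t
  t+t≡2t = solve-∀
  t+t≡1*2t : ∀ t → t + t ≡ 1 * (2 * t)
  t+t≡1*2t = solve-∀
  2t+t≡3t : ∀ t → 2 * t + t ≡ 3 * t
  2t+t≡3t = solve-∀
  1*2t+t≡3t : ∀ t → 1 * (2 * t) + t ≡ 3 * t
  1*2t+t≡3t = solve-∀
  3t+t≡2*2t : ∀ t → 3 * t + t ≡ 2 * (2 * t)
  3t+t≡2*2t = solve-∀
  t<2t : t < 2 * t
  t<2t = subst (t <_) (t+t≡2t t) (m<m+n t 0<t)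
  2t<3t : 2 * t < 3 * t
  2t<3t = subst (2 * t <_) (2t+t≡3t t) (m<m+n (2 * t) 0<t)

orbit-ratio : ∀ {a b r} → 0 < b → b ≤ a → (r ≡ 1 ⊎ r ≡ 2 ⊎ r ≡ 3) → a ∣ r * b →
  a ≡ 1 * b ⊎ a ≡ 2 * b ⊎ a ≡ 3 * b ⊎ ∃[ t ] (0 < t × a ≡ 3 * t × b ≡ 2 * t)
orbit-ratio {a} {b} {r} 0<b b≤a r∈ (divides q rb≡qa) = ratio r∈ q≤r rb≡qa
  where
  instance _ = >-nonZero (<-≤-trans 0<b b≤a)
  q≤r : q ≤ r
  q≤r = *-cancelʳ-≤ q r a (begin
    q * a ≡⟨ rb≡qa ⟨
    r * b ≤⟨ *-monoʳ-≤ r b≤a ⟩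
    r * a ∎)
    where open ≤-Reasoning
  rb≢0 : ∀ r → suc r * b ≢ 0
  rb≢0 r rb≡0 = <⇒≢ 0<b (sym (m+n≡0⇒m≡0 b rb≡0))
  a≡kb : ∀ k → k * b ≡ 1 * a → a ≡ k * b
  a≡kb _ eq = trans (sym (*-identityˡ a)) (sym eq)
  a≡b : ∀ k .{{_ : NonZero k}} → k * b ≡ k * a → a ≡ 1 * b
  a≡b k eq = trans (*-cancelˡ-≡ a b k (sym eq)) (sym (*-identityˡ b))
  ratio : ∀ {r q} → (r ≡ 1 ⊎ r ≡ 2 ⊎ r ≡ 3) → q ≤ r → r * b ≡ q * a →
    a ≡ 1 * b ⊎ a ≡ 2 * b ⊎ a ≡ 3 * b ⊎ ∃[ t ] (0 < t × a ≡ 3 * t × b ≡ 2 * t)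
  ratio (inj₁ refl)        z≤n                   eq = ⊥-elim (rb≢0 0 eq)
  ratio (inj₁ refl)        (s≤s z≤n)             eq = inj₁ (a≡kb 1 eq)
  ratio (inj₂ (inj₁ refl)) z≤n                   eq = ⊥-elim (rb≢0 1 eq)
  ratio (inj₂ (inj₁ refl)) (s≤s z≤n)             eq = inj₂ (inj₁ (a≡kb 2 eq))
  ratio (inj₂ (inj₁ refl)) (s≤s (s≤s z≤n))       eq = inj₁ (a≡b 2 eq)
  ratio (inj₂ (inj₂ refl)) z≤n                   eq = ⊥-elim (rb≢0 2 eq)
  ratio (inj₂ (inj₂ refl)) (s≤s z≤n)             eq = inj₂ (inj₂ (inj₁ (a≡kb 3 eq)))
  ratio (inj₂ (inj₂ refl)) (s≤s (s≤s z≤n))       eq = inj₂ (inj₂ (inj₂ (3b≡2a⇒thirds 0<b b≤a eq)))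
  ratio (inj₂ (inj₂ refl)) (s≤s (s≤s (s≤s z≤n))) eq = inj₁ (a≡b 3 eq)

module Automorphism (Γ : Graph) (g : Aut Γ) where
  open Graph Γ using (n; adj) renaming (sym to adj-sym)
  open Powers Γ (proj₁ g) public
  open import Data.List.Membership.DecPropositional (_≟_ {n}) using (_∈?_)

  private
    σ = proj₁ g

  σ^-adj : ∀ k x y → adj (σ^ k x) (σ^ k y) ≡ adj x y
  σ^-adj zero    x y = refl
  σ^-adj (suc k) x y = trans (proj₂ g _ _) (σ^-adj k x y)

  fixed-Adj : ∀ k {x y} → σ^ k y ≡ y → Adj Γ y x → Adj Γ y (σ^ k x)
  fixed-Adj k {x} {y} fy y~x = begin
    adj y (σ^ k x)        ≡⟨ cong (λ z → adj z (σ^ k x)) fy ⟨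
    adj (σ^ k y) (σ^ k x) ≡⟨ σ^-adj k y x ⟩
    adj y x               ≡⟨ y~x ⟩
    true                  ∎
    where open ≡-Reasoning

  neighbourhood-fixed⇒Twins : ∀ {v k} → HasSize Γ (Adj Γ v) 3 → HasSize Γ (Adj Γ (σ^ k v)) 3 →
    (∀ w → Adj Γ v w → σ^ k w ≡ w) → Twins Γ v (σ^ k v)
  neighbourhood-fixed⇒Twins {v} {k} deg-v deg-σᵏv fixes w =
    ⇔→≡ (mk⇔ (N[v]⊆N[σᵏv] w) (HasSize-⊆⇒⊇ Γ deg-v deg-σᵏv N[v]⊆N[σᵏv] w))
    where
    N[v]⊆N[σᵏv] : ∀ w → Adj Γ v w → Adj Γ (σ^ k v) w
    N[v]⊆N[σᵏv] w v~w =
      trans (cong (adj (σ^ k v)) (sym (fixes w v~w))) (trans (σ^-adj k v w) v~w)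

  StabiliserImage : Fin n → Fin n → Fin n → Set
  StabiliserImage y x w = ∃[ e ] (σ^ e y ≡ y × σ^ e x ≡ w)

  -- When |y^G| = b, the powers of σ fixing y are those of σ^b, so stabiliserOrbit b i x lists the
  -- orbit of x under the stabiliser of y once i is the length of that orbit.
  stabiliserOrbit : ℕ → ℕ → Fin n → List (Fin n)
  stabiliserOrbit b i x = applyUpTo (λ j → σ^ (j * b) x) i

  ∈-stabiliserOrbit⁻ : ∀ {b i x y w} → σ^ b y ≡ y → w ∈ stabiliserOrbit b i x →
    StabiliserImage y x w
  ∈-stabiliserOrbit⁻ {b} {x = x} fy w∈ with ∈-applyUpTo⁻ (λ j → σ^ (j * b) x) w∈
  ... | j , _ , refl = j * b , σ^-*-fixed j fy , refl

  stabiliserOrbit-Adj : ∀ {b i x y w} → σ^ b y ≡ y → Adj Γ y x →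
    w ∈ stabiliserOrbit b i x → Adj Γ y w
  stabiliserOrbit-Adj fy y~x w∈ with ∈-stabiliserOrbit⁻ fy w∈
  ... | e , σᵉy≡y , refl = fixed-Adj e σᵉy≡y y~x

  stabiliserOrbit-Unique : ∀ {b i x} → (∀ d → 0 < d → d < i → σ^ (d * b) x ≢ x) →
    Unique (stabiliserOrbit b i x)
  stabiliserOrbit-Unique {b} {i} {x} moved = applyUpTo⁺₁ _ i distinct
    where
    distinct : ∀ {j j′} → j < j′ → j′ < i → σ^ (j * b) x ≢ σ^ (j′ * b) x
    distinct {j} {j′} j<j′ j′<i eq =
      moved (j′ ∸ j) (m<n⇒0<n∸m j<j′) (≤-<-trans (m∸n≤m j′ j) j′<i)
        (subst (λ e → σ^ e x ≡ x) (sym (*-distribʳ-∸ b j′ j))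
          (σ^-≡⇒return x (*-monoˡ-≤ b (<⇒≤ j<j′)) eq))

  period-stabiliserOrbit-Unique : ∀ {b i x} → 0 < b → Period x (i * b) →
    Unique (stabiliserOrbit b i x)
  period-stabiliserOrbit-Unique {b} 0<b (_ , _ , noReturn) = stabiliserOrbit-Unique λ d 0<d d<i →
    noReturn (d * b) (*-monoˡ-< b {{>-nonZero 0<b}} 0<d) (*-monoˡ-< b {{>-nonZero 0<b}} d<i)

  -- σ^b fixes v, so u, σ^b u, σ^(2b) u and σ^(3b) u are neighbours of v, and two of them coincide.
  stabiliser-returns-within-3 : ∀ {u v b} → HasSize Γ (Adj Γ v) 3 → σ^ b v ≡ v → Adj Γ v u →
    ∃[ r ] ((r ≡ 1 ⊎ r ≡ 2 ⊎ r ≡ 3) × σ^ (r * b) u ≡ u)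
  stabiliser-returns-within-3 {u} {v} {b} deg-v fv v~u
    with σ^ (1 * b) u ≟ u | σ^ (2 * b) u ≟ u | σ^ (3 * b) u ≟ u
  ... | yes fixed | _ | _ = 1 , inj₁ refl , fixed
  ... | no _ | yes fixed | _ = 2 , inj₂ (inj₁ refl) , fixed
  ... | no _ | no _ | yes fixed = 3 , inj₂ (inj₂ refl) , fixed
  ... | no moved₁ | no moved₂ | no moved₃ = ⊥-elim (1+n≰n
    (HasSize⇒length-≤ Γ deg-v (stabiliserOrbit-Unique {b} moved) (stabiliserOrbit-Adj {b} fv v~u)))
    where
    moved : ∀ d → 0 < d → d < 4 → σ^ (d * b) u ≢ u
    moved 1 _ _ = moved₁
    moved 2 _ _ = moved₂
    moved 3 _ _ = moved₃
    moved (suc (suc (suc (suc _)))) _ (s≤s (s≤s (s≤s (s≤s ()))))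

  -- A neighbour σ^m y of x is carried back to y by some σ^c; then σ^c x is a neighbour of y in x^G,
  -- hence a stabiliser image σ^e x, and period-transfer turns σ^c x ≡ σ^e x into σ^c y ≡ y.
  stabiliser-transitive⇒unique-neighbour : ∀ {x y a b} → Period x a → σ^ a y ≡ y → Period y b →
    (∀ w → Adj Γ y w → InOrbit Γ σ x w → StabiliserImage y x w) →
    ∀ {w} → Adj Γ x w → InOrbit Γ σ y w → w ≡ y
  stabiliser-transitive⇒unique-neighbour {x} {y} per-x fy (0<b , fb , _) transitive {w} x~w (m , refl) =
    σ^-injective c (trans undo (sym σᶜy≡y))
    where
    c : ℕ
    c = proj₁ (σ^-undo 0<b fb m)
    undo : σ^ c w ≡ y
    undo = proj₂ (σ^-undo 0<b fb m)
    y~σᶜx : Adj Γ y (σ^ c x)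
    y~σᶜx = trans (cong (λ z → adj z (σ^ c x)) (sym undo))
                  (trans (σ^-adj c w x) (trans (adj-sym w x) x~w))
    σᶜy≡y : σ^ c y ≡ y
    σᶜy≡y with transitive (σ^ c x) y~σᶜx (c , refl)
    ... | e , σᵉy≡y , σᵉx≡σᶜx = trans (sym (period-transfer per-x fy e c σᵉx≡σᶜx)) σᵉy≡y

  stabiliserOrbit-exhausts₃ : ∀ {x y b} → HasSize Γ (Adj Γ y) 3 → σ^ b y ≡ y → Adj Γ y x →
    Unique (stabiliserOrbit b 3 x) → ∀ w → Adj Γ y w → w ∈ stabiliserOrbit b 3 x
  stabiliserOrbit-exhausts₃ {b = b} deg-y fb y~x unique =
    HasSize-exhausted Γ deg-y unique refl (stabiliserOrbit-Adj {b} fb y~x)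

  -- σ^b is a fixed-point-free involution of x^G preserving the neighbours of y, so a third
  -- neighbour of y in x^G would bring a fourth one.
  stabiliserOrbit-exhausts₂ : ∀ {x y b} → HasSize Γ (Adj Γ y) 3 → Period x (2 * b) → Period y b →
    Adj Γ y x → ∀ w → Adj Γ y w → InOrbit Γ σ x w → w ∈ stabiliserOrbit b 2 x
  stabiliserOrbit-exhausts₂ {x} {y} {b} deg-y per-x@(_ , f2b , noReturn) (0<b , fb , _) y~x _ y~w
    (m , refl) with σ^ m x ∈? stabiliserOrbit b 2 x
  ... | yes w∈K = w∈K
  ... | no  w∉K = ⊥-elim (impossible (HasSize-exhausted Γ deg-y
          (¬Any⇒All¬ _ w∉K ∷ period-stabiliserOrbit-Unique 0<b per-x) refl w∷K~y
          (σ^ b w) (fixed-Adj b fb y~w)))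
    where
    w : Fin n
    w = σ^ m x
    2b≡b+b : 2 * b ≡ b + b
    2b≡b+b = cong (b +_) (+-identityʳ b)
    σ¹ᵇx≡σᵇx : σ^ (1 * b) x ≡ σ^ b x
    σ¹ᵇx≡σᵇx = cong (λ e → σ^ e x) (*-identityˡ b)
    σᵇσᵇw≡w : σ^ b (σ^ b w) ≡ w
    σᵇσᵇw≡w = trans (sym (σ^-+ b b w))
      (σ^-fixed-on-orbit {b + b} (subst (λ e → σ^ e x ≡ x) 2b≡b+b f2b) m)
    w∷K~y : ∀ {z} → z ∈ w ∷ stabiliserOrbit b 2 x → Adj Γ y z
    w∷K~y (here refl) = y~w
    w∷K~y (there z∈K) = stabiliserOrbit-Adj {b} fb y~x z∈K
    impossible : σ^ b w ∈ w ∷ stabiliserOrbit b 2 x → ⊥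
    impossible (here σᵇw≡w) = noReturn b 0<b (subst (b <_) (sym 2b≡b+b) (m<m+n b 0<b))
      (σ^-injective m (trans (σ^-comm m b x) σᵇw≡w))
    impossible (there (here σᵇw≡x)) =
      w∉K (there (here (trans (trans (sym σᵇσᵇw≡w) (cong (σ^ b) σᵇw≡x)) (sym σ¹ᵇx≡σᵇx))))
    impossible (there (there (here σᵇw≡σ¹ᵇx))) =
      w∉K (here (σ^-injective b (trans σᵇw≡σ¹ᵇx σ¹ᵇx≡σᵇx)))

  neighbour-counts : ∀ {x y i b} → Period x (i * b) → Period y b → Adj Γ x y →
    (∀ w → Adj Γ y w → InOrbit Γ σ x w → w ∈ stabiliserOrbit b i x) →
    NbrsIn Γ x (InOrbit Γ σ y) 1 × NbrsIn Γ y (InOrbit Γ σ x) i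
  neighbour-counts {x} {y} {i} {b} per-x per-y@(0<b , fb , _) x~y exhausts =
      (y ∷ [] , All.[] ∷ [] ,
       (λ w → mk⇔ (λ { (here refl) → x~y , 0 , refl }) (here ∘ only-y)) , refl)
    , (stabiliserOrbit b i x , period-stabiliserOrbit-Unique 0<b per-x ,
       (λ w → mk⇔ (λ w∈K → stabiliserOrbit-Adj {b} fb y~x w∈K , in-orbit w∈K)
                  (λ (y~w , w∈xᴳ) → exhausts w y~w w∈xᴳ)) ,
       length-applyUpTo _ i)
    where
    y~x : Adj Γ y x
    y~x = trans (adj-sym y x) x~y
    in-orbit : ∀ {w} → w ∈ stabiliserOrbit b i x → InOrbit Γ σ x w
    in-orbit w∈K with ∈-stabiliserOrbit⁻ {b} fb w∈K
    ... | e , _ , σᵉx≡w = e , σᵉx≡w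
    only-y : ∀ {w} → Adj Γ x w × InOrbit Γ σ y w → w ≡ y
    only-y (x~w , w∈yᴳ) = stabiliser-transitive⇒unique-neighbour per-x (σ^-*-fixed i fb) per-y
      (λ w y~w w∈xᴳ → ∈-stabiliserOrbit⁻ {b} fb (exhausts w y~w w∈xᴳ)) x~w w∈yᴳ

  Biregular : Fin n → Fin n → ℕ → Set
  Biregular u v i = (∀ x → InOrbit Γ σ u x → NbrsIn Γ x (InOrbit Γ σ v) 1) ×
                    (∀ y → InOrbit Γ σ v y → NbrsIn Γ y (InOrbit Γ σ u) i)

  orbit-neighbour-counts : (∀ z → HasSize Γ (Adj Γ z) 3) → ∀ {u v i b} → (i ≡ 2 ⊎ i ≡ 3) →
    Period u (i * b) → Period v b → Adj Γ u v → Biregular u v i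
  orbit-neighbour-counts deg {u} {v} {i} {b} i∈ per-u per-v u~v =
      (λ { _ (k , refl) → NbrsIn-cong Γ (orbit-shift per-v k) (proj₁ (counts k)) })
    , (λ { _ (k , refl) → NbrsIn-cong Γ (orbit-shift per-u k) (proj₂ (counts k)) })
    where
    counts : ∀ k → NbrsIn Γ (σ^ k u) (InOrbit Γ σ (σ^ k v)) 1 ×
                   NbrsIn Γ (σ^ k v) (InOrbit Γ σ (σ^ k u)) i
    counts k = neighbour-counts per-x per-y (trans (σ^-adj k u v) u~v) (exhausts i∈)
      where
      per-x : Period (σ^ k u) (i * b)
      per-x = period-shift per-u k
      per-y : Period (σ^ k v) b
      per-y = period-shift per-v k
      y~x : Adj Γ (σ^ k v) (σ^ k u)
      y~x = trans (σ^-adj k v u) (trans (adj-sym v u) u~v)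
      exhausts : (i ≡ 2 ⊎ i ≡ 3) →
        ∀ w → Adj Γ (σ^ k v) w → InOrbit Γ σ (σ^ k u) w → w ∈ stabiliserOrbit b i (σ^ k u)
      exhausts (inj₁ refl) = stabiliserOrbit-exhausts₂ (deg _) per-x per-y y~x
      exhausts (inj₂ refl) w y~w _ =
        stabiliserOrbit-exhausts₃ {b = b} (deg _) (proj₁ (proj₂ per-y)) y~x
          (period-stabiliserOrbit-Unique {b} (proj₁ per-v) per-x) w y~w

  -- σ^(3t) fixes u^G pointwise, and the three neighbours u, σ^(2t) u, σ^(4t) u of v lie in u^G.
  orbit-ratio-3:2⇒twins : (∀ z → HasSize Γ (Adj Γ z) 3) → ∀ {u v t} → 0 < t →
    Period u (3 * t) → Period v (2 * t) → Adj Γ v u → v ≢ σ^ (3 * t) v × Twins Γ v (σ^ (3 * t) v)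
  orbit-ratio-3:2⇒twins deg {u} {v} {t} 0<t per-u@(_ , fu , _) per-v@(_ , fv , _) v~u =
    v≢σ³ᵗv , neighbourhood-fixed⇒Twins {k = 3 * t} (deg v) (deg _) σ³ᵗ-fixes-N[v]
    where
    nondivisibility : 2 * t ∤ 3 * t × 3 * t ∤ 1 * (2 * t) × 3 * t ∤ 2 * (2 * t)
    nondivisibility = ratio-3:2-nondivisibility 0<t
    v≢σ³ᵗv : v ≢ σ^ (3 * t) v
    v≢σ³ᵗv v≡σ³ᵗv = proj₁ nondivisibility (period-fixed⇒∣ per-v (sym v≡σ³ᵗv))
    moved : ∀ d → 0 < d → d < 3 → σ^ (d * (2 * t)) u ≢ u
    moved 1 _ _ = proj₁ (proj₂ nondivisibility) ∘ period-fixed⇒∣ per-u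
    moved 2 _ _ = proj₂ (proj₂ nondivisibility) ∘ period-fixed⇒∣ per-u
    moved (suc (suc (suc _))) _ (s≤s (s≤s (s≤s ())))
    σ³ᵗ-fixes-N[v] : ∀ w → Adj Γ v w → σ^ (3 * t) w ≡ w
    σ³ᵗ-fixes-N[v] w v~w with ∈-stabiliserOrbit⁻ {2 * t} fv
      (stabiliserOrbit-exhausts₃ {b = 2 * t} (deg v) fv v~u (stabiliserOrbit-Unique {2 * t} moved) w v~w)
    ... | e , _ , refl = σ^-fixed-on-orbit {3 * t} fu e

lemma4p5 : (Γ : Graph) → Cubic Γ → VertexTransitive Γ → ¬ Isomorphic Γ K33 →
    (g : Aut Γ) → (u v : Fin (Graph.n Γ)) → Adj Γ u v →
    ¬ InOrbit Γ (proj₁ g) u v →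
    (a b : ℕ) → HasSize Γ (InOrbit Γ (proj₁ g) u) a → HasSize Γ (InOrbit Γ (proj₁ g) v) b →
    b ≤ a →
    ∃[ i ] ((i ≡ 1 ⊎ i ≡ 2 ⊎ i ≡ 3) × (a ≡ i * b) ×
      (i ≢ 1 →
        (∀ x → InOrbit Γ (proj₁ g) u x → NbrsIn Γ x (InOrbit Γ (proj₁ g) v) 1) ×
        (∀ y → InOrbit Γ (proj₁ g) v y → NbrsIn Γ y (InOrbit Γ (proj₁ g) u) i)))
lemma4p5 Γ cubic@(_ , deg) vt Γ≇K33 g u v u~v _ a b |uᴳ|≡a |vᴳ|≡b b≤a =
  classify orbit-sizes
  where
  open Automorphism Γ g
  per-u : Period u a
  per-u = orbit-size⇒period |uᴳ|≡a
  per-v : Period v b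
  per-v = orbit-size⇒period |vᴳ|≡b
  v~u : Adj Γ v u
  v~u = trans (Graph.sym Γ v u) u~v
  orbit-sizes : a ≡ 1 * b ⊎ a ≡ 2 * b ⊎ a ≡ 3 * b ⊎ ∃[ t ] (0 < t × a ≡ 3 * t × b ≡ 2 * t)
  orbit-sizes with stabiliser-returns-within-3 (deg v) (proj₁ (proj₂ per-v)) v~u
  ... | _ , r∈ , σʳᵇu≡u = orbit-ratio (proj₁ per-v) b≤a r∈ (period-fixed⇒∣ per-u σʳᵇu≡u)
  counts : ∀ {i} → (i ≡ 2 ⊎ i ≡ 3) → a ≡ i * b → Biregular u v i
  counts i∈ a≡ib = orbit-neighbour-counts deg i∈ (subst (Period u) a≡ib per-u) per-v u~v
  classify : a ≡ 1 * b ⊎ a ≡ 2 * b ⊎ a ≡ 3 * b ⊎ ∃[ t ] (0 < t × a ≡ 3 * t × b ≡ 2 * t) →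
    ∃[ i ] ((i ≡ 1 ⊎ i ≡ 2 ⊎ i ≡ 3) × a ≡ i * b × (i ≢ 1 → Biregular u v i))
  classify (inj₁ a≡b)                 = 1 , inj₁ refl , a≡b , λ 1≢1 → ⊥-elim (1≢1 refl)
  classify (inj₂ (inj₁ a≡2b))         = 2 , inj₂ (inj₁ refl) , a≡2b , λ _ → counts (inj₁ refl) a≡2b
  classify (inj₂ (inj₂ (inj₁ a≡3b)))  = 3 , inj₂ (inj₂ refl) , a≡3b , λ _ → counts (inj₂ refl) a≡3b
  classify (inj₂ (inj₂ (inj₂ (t , 0<t , refl , refl)))) =
    ⊥-elim (Γ≇K33 (uncurry (twins⇒K33 Γ cubic vt) (orbit-ratio-3:2⇒twins deg 0<t per-u per-v v~u)))
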